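{- Let $T\in\mathbb{F}^{n_1}\otimes\mathbb{F}^{n_2}\otimes\mathbb{F}^{n_3}$ be concise and let $i,j,k\in[3]$ be distinct. Suppose $|\mathbb{F}|>n_k$. Then $Q_i(T)\,Q_j(T)\geq n_k$.
   Context: For $T=\sum_{a,b,c}T_{a,b,c}e_a\otimes e_b\otimes e_c$, the 1-slices are $T^{(1)}_a=\sum_{b,c}T_{a,b,c}e_b\otimes e_c$ ($a\in[n_1]$), the 2-slices $T^{(2)}_b=\sum_{a,c}T_{a,b,c}e_a\otimes e_c$, and the 3-slices $T^{(3)}_c=\sum_{a,b}T_{a,b,c}e_a\otimes e_b$, viewed as matrices. For $\ell\in[3]$, $Q_\ell(T)$ is the maximum matrix rank of an element of the linear span of the $\ell$-slices of $T$. $T$ is concise if each flattening $T_i\in\mathbb{F}^{n_i}\otimes(\mathbb{F}^{n_j}\otimes\mathbb{F}^{n_k})$ (an $n_i\times n_jn_k$ matrix) has rank $n_i$. -}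

module Defs where

open import Level using (Level; _⊔_) renaming (suc to lsuc)
open import Data.Nat using (ℕ; zero; suc; _≤_)
open import Data.Fin using (Fin; zero; suc)
open import Data.Product using (Σ; ∃; _×_; _,_)
open import Relation.Nullary using (¬_)
open import Algebra.Bundles using (CommutativeRing)

record Field (c ℓ : Level) : Set (lsuc (c ⊔ ℓ)) where
  field
    commutativeRing : CommutativeRing c ℓ
  open CommutativeRing commutativeRing public
    using (Carrier; _≈_; _+_; _*_; 0#; 1#)
  field
    0≉1     : ¬ (0# ≈ 1#)
    inverse : ∀ x → ¬ (x ≈ 0#) → Σ Carrier λ y → (x * y) ≈ 1#

module _ {c ℓ : Level} (F : Field c ℓ) where
  open Field F using (Carrier; _≈_; _+_; _*_; 0#)

  ∑ : (r : ℕ) → (Fin r → Carrier) → Carrier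
  ∑ zero    f = 0#
  ∑ (suc r) f = f zero + ∑ r (λ t → f (suc t))

  Matrix : ∀ {a} → ℕ → Set a → Set (c ⊔ a)
  Matrix m C = Fin m → C → Carrier

  IndepRows : ∀ {a} {m : ℕ} {C : Set a} → Matrix m C → (r : ℕ) → (Fin r → Fin m) → Set (c ⊔ ℓ ⊔ a)
  IndepRows M r f =
    (λc : Fin r → Carrier) →
    (∀ col → ∑ r (λ t → λc t * M (f t) col) ≈ 0#) →
    ∀ t → λc t ≈ 0#

  RankAtLeast : ∀ {a} {m : ℕ} {C : Set a} → Matrix m C → ℕ → Set (c ⊔ ℓ ⊔ a)
  RankAtLeast {m = m} M r = Σ (Fin r → Fin m) λ f → IndepRows M r f

  IsRank : ∀ {a} {m : ℕ} {C : Set a} → Matrix m C → ℕ → Set (c ⊔ ℓ ⊔ a)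
  IsRank M r = RankAtLeast M r × (∀ s → RankAtLeast M s → s ≤ r)

  Tensor : ℕ → ℕ → ℕ → Set c
  Tensor n₁ n₂ n₃ = Fin n₁ → Fin n₂ → Fin n₃ → Carrier

  module _ {n₁ n₂ n₃ : ℕ} where

    dim : Fin 3 → ℕ
    dim zero             = n₁
    dim (suc zero)       = n₂
    dim (suc (suc zero)) = n₃

    sliceRows sliceCols : Fin 3 → ℕ
    sliceRows zero             = n₂
    sliceRows (suc zero)       = n₁
    sliceRows (suc (suc zero)) = n₁
    sliceCols zero             = n₃
    sliceCols (suc zero)       = n₃
    sliceCols (suc (suc zero)) = n₂

    slice : Tensor n₁ n₂ n₃ → (l : Fin 3) → Fin (dim l) →
            Matrix (sliceRows l) (Fin (sliceCols l))
    slice T zero             a b c' = T a b c'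
    slice T (suc zero)       b a c' = T a b c'
    slice T (suc (suc zero)) c' a b = T a b c'

    sliceComb : Tensor n₁ n₂ n₃ → (l : Fin 3) → (Fin (dim l) → Carrier) →
                Matrix (sliceRows l) (Fin (sliceCols l))
    sliceComb T l x u v = ∑ (dim l) (λ a → x a * slice T l a u v)

    IsQ : Tensor n₁ n₂ n₃ → Fin 3 → ℕ → Set (c ⊔ ℓ)
    IsQ T l q =
      Σ (Fin (dim l) → Carrier) (λ x → IsRank (sliceComb T l x) q) ×
      (∀ x r → IsRank (sliceComb T l x) r → r ≤ q)

    flatCols : Fin 3 → Set
    flatCols zero             = Fin n₂ × Fin n₃
    flatCols (suc zero)       = Fin n₁ × Fin n₃
    flatCols (suc (suc zero)) = Fin n₁ × Fin n₂

    flattening : Tensor n₁ n₂ n₃ → (l : Fin 3) → Matrix (dim l) (flatCols l)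
    flattening T zero             a  (b , c') = T a b c'
    flattening T (suc zero)       b  (a , c') = T a b c'
    flattening T (suc (suc zero)) c' (a , b)  = T a b c'

    Concise : Tensor n₁ n₂ n₃ → Set (c ⊔ ℓ)
    Concise T = ∀ l → IsRank (flattening T l) (dim l)

  CardGreaterThan : ℕ → Set (c ⊔ ℓ)
  CardGreaterThan n = Σ (Fin (suc n) → Carrier) λ e → ∀ s t → e s ≈ e t → s ≡ t
    where open import Relation.Binary.PropositionalEquality using (_≡_)

-- Order the factors as (i, j, k) and let P x = Σₐ xₐ Tₐ (the span of the i-slices, as n_j × n_k
-- matrices) and R y = Σ_b y_b T_b (the j-slices, as n_i × n_k matrices). Fix x₀ with
-- rank P x₀ = Q_i = r and rows g₁ … g_r of P x₀ spanning its row space. If z P x₀ = 0 then z P x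
-- lies in that row space for every x: otherwise, for r + 1 distinct nonzero μ (this is where
-- |F| > n_k is used) the r + 1 vectors z P(x₀ + μx), P(x₀ + μx)_{g_t} would be dependent, and each
-- dependence yields an eigenvector of one fixed r × r matrix for the eigenvalue -1/μ. Taking
-- z = e_b - Σ_t c_{bt} e_{g_t}, where row b of P x₀ is Σ_t c_{bt} (row g_t), every fibre T_{a,b,·}
-- lies in the sum of the row spaces of the R(e_{g_t}), each of dimension ≤ Q_j. Conciseness makes
-- these fibres span F^{n_k}, so n_k ≤ Q_i Q_j.
--
-- Equality in F is not assumed decidable, so bases and ranks are handled under double negation;
-- the conclusion, an inequality of natural numbers, is decidable and hence stable.

module Submission where

open import Defs
open import Level using (Level; _⊔_)
open import Data.Nat using (ℕ; _≤_; _*_)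
open import Data.Fin using (Fin)
open import Relation.Binary.PropositionalEquality using (_≢_)

open import Data.Nat as ℕ using (zero; suc; _<_; z≤n; s≤s; _≤?_)
import Data.Nat.Properties as ℕ
open import Data.Fin as Fin using (zero; suc; punchIn)
open import Data.Fin.Patterns using (0F; 1F; 2F)
import Data.Fin.Properties as Fin
open import Data.Product using (Σ; ∃; _×_; _,_; proj₁; proj₂; uncurry; swap; map₂)
open import Data.Empty using (⊥; ⊥-elim)
open import Data.Sum using (_⊎_; inj₁; inj₂)
open import Data.Sum.Properties using ([,]-∘; [,]-map)
open import Data.Vec.Functional using (_∷_; _++_; concat; insertAt)
open import Data.Vec.Functional.Properties using (insertAt-lookup; insertAt-punchIn)
open import Data.Unit using (tt)
open import Function using (_∘_; flip)
open import Relation.Nullary using (¬_; Dec; yes; no; contradiction)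
open import Relation.Nullary.Decidable using (decidable-stable; ¬¬-excluded-middle)
open import Relation.Binary.PropositionalEquality as ≡ using (_≡_)
open import Algebra.Bundles using (CommutativeRing)
import Algebra.Properties.CommutativeSemigroup

_>>=_ : ∀ {a b} {A : Set a} {B : Set b} → ¬ ¬ A → (A → ¬ ¬ B) → ¬ ¬ B
(m >>= f) k = m (λ x → f x k)

pure : ∀ {a} {A : Set a} → A → ¬ ¬ A
pure x k = k x

¬¬-Π-Fin : ∀ {a} n {B : Fin n → Set a} → (∀ i → ¬ ¬ B i) → ¬ ¬ (∀ i → B i)
¬¬-Π-Fin zero    h = pure λ ()
¬¬-Π-Fin (suc n) h = do
  b₀ ← h zero
  bs ← ¬¬-Π-Fin n (h ∘ suc)
  pure λ { zero → b₀ ; (suc i) → bs i }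

module LinearAlgebra {c ℓ} (F : Field c ℓ) where

  open Field F using (commutativeRing; 0≉1; inverse)
  open CommutativeRing commutativeRing public
    hiding (zero) renaming (_*_ to _·_)
  open import Algebra.Properties.Ring ring public
  open import Algebra.Properties.Semiring.Sum semiring public
    using (sum; sum-syntax; sum-cong-≋; sum-cong-≗; sum-replicate-zero; ∑-distrib-+; ∑-comm; sum-remove;
           *-distribˡ-sum; *-distribʳ-sum)
  open import Relation.Binary.Reasoning.Setoid setoid public

  ∑≡sum : ∀ r (f : Fin r → Carrier) → ∑ F r f ≡ sum f
  ∑≡sum zero    f = ≡.refl
  ∑≡sum (suc r) f = ≡.cong (f zero +_) (∑≡sum r (f ∘ suc))

  sum-zero : ∀ {r} {f : Fin r → Carrier} → (∀ t → f t ≈ 0#) → sum f ≈ 0#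
  sum-zero {r} f≈0 = trans (sum-cong-≋ f≈0) (sum-replicate-zero r)

  sum-neg : ∀ {r} (f : Fin r → Carrier) → sum (λ t → - f t) ≈ - sum f
  sum-neg f = begin
    sum (λ t → - f t)       ≈⟨ sum-cong-≋ (λ t → -1*x≈-x (f t)) ⟨
    sum (λ t → - 1# · f t)  ≈⟨ *-distribˡ-sum (- 1#) f ⟨
    - 1# · sum f            ≈⟨ -1*x≈-x (sum f) ⟩
    - sum f                 ∎

  sum-distrib-sub : ∀ {r} (f g : Fin r → Carrier) → sum (λ t → f t - g t) ≈ sum f - sum g
  sum-distrib-sub f g = trans (∑-distrib-+ f (λ t → - g t)) (+-congˡ (sum-neg g))

  sum-++ : ∀ {m n} (xs : Fin m → Carrier) (ys : Fin n → Carrier) → sum (xs ++ ys) ≈ sum xs + sum ys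
  sum-++ {zero}  xs ys = sym (+-identityˡ (sum ys))
  sum-++ {suc m} xs ys = begin
    xs zero + sum ((xs ++ ys) ∘ suc)      ≡⟨ ≡.cong (xs zero +_) (sum-cong-≗ (λ i → [,]-map (Fin.splitAt m i))) ⟩
    xs zero + sum ((xs ∘ suc) ++ ys)      ≈⟨ +-congˡ (sum-++ (xs ∘ suc) ys) ⟩
    xs zero + (sum (xs ∘ suc) + sum ys)   ≈⟨ +-assoc (xs zero) (sum (xs ∘ suc)) (sum ys) ⟨
    sum xs + sum ys                       ∎

  sum-concat : ∀ {r q} (xss : Fin r → Fin q → Carrier) → sum (concat xss) ≈ ∑[ t < r ] sum (xss t)
  sum-concat {zero}      xss = refl
  sum-concat {suc r} {q} xss = begin
    sum (concat xss)                            ≡⟨ sum-cong-≗ (λ i → [,]-∘ (uncurry (flip xss)) (Fin.splitAt q i)) ⟩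
    sum (xss zero ++ concat (xss ∘ suc))        ≈⟨ sum-++ (xss zero) (concat (xss ∘ suc)) ⟩
    sum (xss zero) + sum (concat (xss ∘ suc))   ≈⟨ +-congˡ (sum-concat (xss ∘ suc)) ⟩
    ∑[ t < suc r ] sum (xss t)                  ∎

  δ : ∀ {n} → Fin n → Fin n → Carrier
  δ zero    zero    = 1#
  δ zero    (suc _) = 0#
  δ (suc _) zero    = 0#
  δ (suc s) (suc t) = δ s t

  δ-sym : ∀ {n} (s t : Fin n) → δ s t ≡ δ t s
  δ-sym zero    zero    = ≡.refl
  δ-sym zero    (suc t) = ≡.refl
  δ-sym (suc s) zero    = ≡.refl
  δ-sym (suc s) (suc t) = δ-sym s t

  sum-δˡ : ∀ {r} (s : Fin r) (f : Fin r → Carrier) → sum (λ t → δ s t · f t) ≈ f s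
  sum-δˡ zero    f = trans (+-cong (*-identityˡ (f zero)) (sum-zero (λ t → zeroˡ (f (suc t))))) (+-identityʳ _)
  sum-δˡ (suc s) f = trans (+-cong (zeroˡ (f zero)) (sum-δˡ s (f ∘ suc))) (+-identityˡ _)

  sum-δʳ : ∀ {r} (s : Fin r) (f : Fin r → Carrier) → sum (λ t → f t · δ t s) ≈ f s
  sum-δʳ s f = trans (sum-cong-≋ (λ t → trans (*-comm (f t) _) (*-congʳ (reflexive (δ-sym t s))))) (sum-δˡ s f)

  module ·-Props = Algebra.Properties.CommutativeSemigroup *-commutativeSemigroup

  x-y+y≈x : ∀ x y → (x - y) + y ≈ x
  x-y+y≈x x y = trans (+-assoc x (- y) y) (trans (+-congˡ (-‿inverseˡ y)) (+-identityʳ x))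

  x·y≈0⇒x≈0 : ∀ {x y} → x · y ≈ 0# → y ≉ 0# → x ≈ 0#
  x·y≈0⇒x≈0 {x} {y} xy≈0 y≉0 = begin
    x             ≈⟨ *-identityʳ x ⟨
    x · 1#        ≈⟨ *-congˡ y·y⁻¹≈1 ⟨
    x · (y · y⁻¹) ≈⟨ *-assoc x y y⁻¹ ⟨
    (x · y) · y⁻¹ ≈⟨ *-congʳ xy≈0 ⟩
    0# · y⁻¹      ≈⟨ zeroˡ y⁻¹ ⟩
    0#            ∎
    where
      y⁻¹ = proj₁ (inverse y y≉0)
      y·y⁻¹≈1 = proj₂ (inverse y y≉0)

  Nontrivial : ∀ {n} → (Fin n → Carrier) → Set ℓ
  Nontrivial x = ∃ λ j → x j ≉ 0#

  zero-or-nontrivial : ∀ {n} (x : Fin n → Carrier) → ¬ ¬ ((∀ j → x j ≈ 0#) ⊎ Nontrivial x)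
  zero-or-nontrivial {n} x = do
    x≈0? ← ¬¬-Π-Fin n (λ j → ¬¬-excluded-middle)
    pure (case (Fin.all? x≈0?) x≈0?)
    where
      case : Dec (∀ j → x j ≈ 0#) → (∀ j → Dec (x j ≈ 0#)) → (∀ j → x j ≈ 0#) ⊎ Nontrivial x
      case (yes x≈0) _    = inj₁ x≈0
      case (no  x≉0) x≈0? = inj₂ (Fin.¬∀⟶∃¬ n _ x≈0? x≉0)

  ⟨_,_⟩ : ∀ {n} → (Fin n → Carrier) → (Fin n → Carrier) → Carrier
  ⟨ φ , v ⟩ = sum (λ c → φ c · v c)

  infixr 7 _⊙_
  _⊙_ : ∀ {a} {Col : Set a} {s} → (Fin s → Carrier) → (Fin s → Col → Carrier) → Col → Carrier
  (x ⊙ v) col = sum (λ u → x u · v u col)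

  module _ {a} {Col : Set a} where

    infix 4 _≐_
    _≐_ : (Col → Carrier) → (Col → Carrier) → Set (a ⊔ ℓ)
    v ≐ w = ∀ col → v col ≈ w col

    0v : Col → Carrier
    0v _ = 0#

    Dependent : ∀ {s} → (Fin s → Col → Carrier) → Set (a ⊔ c ⊔ ℓ)
    Dependent v = Σ _ λ x → x ⊙ v ≐ 0v × Nontrivial x

    Independent : ∀ {s} → (Fin s → Col → Carrier) → Set (a ⊔ c ⊔ ℓ)
    Independent v = ∀ x → x ⊙ v ≐ 0v → ∀ u → x u ≈ 0#

    InSpan : ∀ {r} → (Fin r → Col → Carrier) → (Col → Carrier) → Set (a ⊔ c ⊔ ℓ)
    InSpan w v = Σ _ λ κ → v ≐ κ ⊙ w

    independent⇒¬dependent : ∀ {s} {v : Fin s → Col → Carrier} → Independent v → ¬ Dependent v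
    independent⇒¬dependent ind (x , x⊙v≈0 , j , xj≉0) = xj≉0 (ind x x⊙v≈0 j)

    ⊙-cong : ∀ {s} {x y : Fin s → Carrier} {v w : Fin s → Col → Carrier} →
             (∀ u → x u ≈ y u) → (∀ u → v u ≐ w u) → x ⊙ v ≐ y ⊙ w
    ⊙-cong x≈y v≐w col = sum-cong-≋ (λ u → *-cong (x≈y u) (v≐w u col))

    ⊙-assoc : ∀ {s r : ℕ} (x : Fin s → Carrier) (A : Fin s → Fin r → Carrier) (w : Fin r → Col → Carrier) →
              x ⊙ (λ u → A u ⊙ w) ≐ (x ⊙ A) ⊙ w
    ⊙-assoc {s} {r} x A w col = begin
      ∑[ u < s ] (x u · ∑[ t < r ] (A u t · w t col))
        ≈⟨ sum-cong-≋ (λ u → *-distribˡ-sum (x u) (λ t → A u t · w t col)) ⟩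
      ∑[ u < s ] ∑[ t < r ] (x u · (A u t · w t col))
        ≈⟨ ∑-comm (λ u t → x u · (A u t · w t col)) ⟩
      ∑[ t < r ] ∑[ u < s ] (x u · (A u t · w t col))
        ≈⟨ sum-cong-≋ (λ t → sum-cong-≋ (λ u → *-assoc (x u) (A u t) (w t col))) ⟨
      ∑[ t < r ] ∑[ u < s ] ((x u · A u t) · w t col)
        ≈⟨ sum-cong-≋ (λ t → *-distribʳ-sum (w t col) (λ u → x u · A u t)) ⟨
      ∑[ t < r ] ((x ⊙ A) t · w t col)
        ∎

    ⊙-distribˡ : ∀ {s} (x y : Fin s → Carrier) (v : Fin s → Col → Carrier) →
                 (λ u → x u + y u) ⊙ v ≐ λ col → (x ⊙ v) col + (y ⊙ v) col
    ⊙-distribˡ x y v col = trans (sum-cong-≋ (λ u → distribʳ (v u col) (x u) (y u)))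
                                 (∑-distrib-+ (λ u → x u · v u col) (λ u → y u · v u col))

    ⊙-scaleˡ : ∀ {s} μ (x : Fin s → Carrier) (v : Fin s → Col → Carrier) →
               (λ u → μ · x u) ⊙ v ≐ λ col → μ · (x ⊙ v) col
    ⊙-scaleˡ μ x v col = trans (sum-cong-≋ (λ u → *-assoc μ (x u) (v u col)))
                               (sym (*-distribˡ-sum μ (λ u → x u · v u col)))

    ⊙-distribʳ : ∀ {s} (x : Fin s → Carrier) (v w : Fin s → Col → Carrier) →
                 x ⊙ (λ u col → v u col + w u col) ≐ λ col → (x ⊙ v) col + (x ⊙ w) col
    ⊙-distribʳ x v w col = trans (sum-cong-≋ (λ u → distribˡ (x u) (v u col) (w u col)))
                                 (∑-distrib-+ (λ u → x u · v u col) (λ u → x u · w u col))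

    ⊙-scaleʳ : ∀ {s} μ (x : Fin s → Carrier) (v : Fin s → Col → Carrier) →
               x ⊙ (λ u col → μ · v u col) ≐ λ col → μ · (x ⊙ v) col
    ⊙-scaleʳ μ x v col = trans (sum-cong-≋ (λ u → ·-Props.x∙yz≈y∙xz (x u) μ (v u col)))
                               (sym (*-distribˡ-sum μ (λ u → x u · v u col)))

    δ-⊙ : ∀ {s} (t : Fin s) (v : Fin s → Col → Carrier) → δ t ⊙ v ≐ v t
    δ-⊙ t v col = sum-δˡ t (λ u → v u col)

  module GaussStep {m n} (v : Fin (suc n) → Fin (suc m) → Carrier)
                   (j : Fin (suc n)) (vj≉0 : v j zero ≉ 0#) where

    private
      y : Carrier
      y = proj₁ (inverse (v j zero) vj≉0)

      a : Fin n → Carrier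
      a k = v (punchIn j k) zero

      σ : (Fin n → Carrier) → Carrier
      σ μ = ⟨ μ , a ⟩

    reduced : Fin n → Fin m → Carrier
    reduced k i = v (punchIn j k) (suc i) - (a k · y) · v j (suc i)

    -- The pivot coefficient is chosen so that column zero cancels.
    lift : (Fin n → Carrier) → Fin (suc n) → Carrier
    lift μ = insertAt μ j (- (y · σ μ))

    private
      lift-⊙ : ∀ μ i → (lift μ ⊙ v) i ≈ - (y · σ μ) · v j i + (μ ⊙ (v ∘ punchIn j)) i
      lift-⊙ μ i = trans (sum-remove {i = j} (λ k → lift μ k · v k i))
        (+-cong (*-congʳ (reflexive (insertAt-lookup μ j _)))
                (sum-cong-≋ (λ k → *-congʳ (reflexive (insertAt-punchIn μ j _ k)))))

      scaled-sum : ∀ μ b → ∑[ k < n ] (μ k · ((a k · y) · b)) ≈ (y · σ μ) · b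
      scaled-sum μ b = begin
        ∑[ k < n ] (μ k · ((a k · y) · b))
          ≈⟨ sum-cong-≋ (λ k → trans (*-congˡ (*-assoc (a k) y b)) (sym (*-assoc (μ k) (a k) (y · b)))) ⟩
        ∑[ k < n ] ((μ k · a k) · (y · b))
          ≈⟨ *-distribʳ-sum (y · b) (λ k → μ k · a k) ⟨
        σ μ · (y · b)
          ≈⟨ ·-Props.x∙yz≈yx∙z (σ μ) y b ⟩
        (y · σ μ) · b
          ∎

    lift-relation : ∀ {μ} → μ ⊙ reduced ≐ 0v → lift μ ⊙ v ≐ 0v
    lift-relation {μ} _ zero = begin
      (lift μ ⊙ v) zero
        ≈⟨ lift-⊙ μ zero ⟩
      - (y · σ μ) · v j zero + σ μ
        ≈⟨ +-congʳ (-‿distribˡ-* (y · σ μ) (v j zero)) ⟨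
      - ((y · σ μ) · v j zero) + σ μ
        ≈⟨ +-congʳ (-‿cong (·-Props.xy∙z≈y∙zx y (σ μ) (v j zero))) ⟩
      - (σ μ · (v j zero · y)) + σ μ
        ≈⟨ +-congʳ (-‿cong (trans (*-congˡ (proj₂ (inverse (v j zero) vj≉0))) (*-identityʳ (σ μ)))) ⟩
      - σ μ + σ μ
        ≈⟨ -‿inverseˡ (σ μ) ⟩
      0#
        ∎
    lift-relation {μ} μ⊙reduced≈0 (suc i) = begin
      (lift μ ⊙ v) (suc i)
        ≈⟨ lift-⊙ μ (suc i) ⟩
      - (y · σ μ) · b + T
        ≈⟨ +-comm _ T ⟩
      T + - (y · σ μ) · b
        ≈⟨ +-congˡ (trans (-‿cong (scaled-sum μ b)) (-‿distribˡ-* (y · σ μ) b)) ⟨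
      T - ∑[ k < n ] (μ k · ((a k · y) · b))
        ≈⟨ sum-distrib-sub (λ k → μ k · v (punchIn j k) (suc i)) (λ k → μ k · ((a k · y) · b)) ⟨
      ∑[ k < n ] (μ k · v (punchIn j k) (suc i) - μ k · ((a k · y) · b))
        ≈⟨ sum-cong-≋ (λ k → x[y-z]≈xy-xz (μ k) _ _) ⟨
      (μ ⊙ reduced) i
        ≈⟨ μ⊙reduced≈0 i ⟩
      0#
        ∎
      where
        b = v j (suc i)
        T = (μ ⊙ (v ∘ punchIn j)) (suc i)

    lift-nontrivial : ∀ {μ} → Nontrivial μ → Nontrivial (lift μ)
    lift-nontrivial {μ} (k , μk≉0) = punchIn j k , λ e → μk≉0 (trans (sym (reflexive (insertAt-punchIn μ j _ k))) e)

  dependent-of-dim< : ∀ {m n} → m < n → (v : Fin n → Fin m → Carrier) → ¬ ¬ Dependent v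
  dependent-of-dim< {zero} {suc n} _ v = pure ((λ _ → 1#) , (λ ()) , zero , λ 1≈0 → 0≉1 (sym 1≈0))
  dependent-of-dim< {suc m} {suc n} (s≤s m<n) v = zero-or-nontrivial (λ j → v j zero) >>= λ where
    (inj₁ column₀≈0) → do
      (x , x⊙v≈0 , x≢0) ← dependent-of-dim< (ℕ.m<n⇒m<1+n m<n) (λ j i → v j (suc i))
      pure (x , (λ { zero → sum-zero (λ j → trans (*-congˡ (column₀≈0 j)) (zeroʳ (x j))) ; (suc i) → x⊙v≈0 i }) , x≢0)
    (inj₂ (j , vj≉0)) → do
      let open GaussStep v j vj≉0
      (μ , μ⊙reduced≈0 , μ≢0) ← dependent-of-dim< m<n reduced
      pure (lift μ , lift-relation μ⊙reduced≈0 , lift-nontrivial μ≢0)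

  module _ {a} {Col : Set a} where

    InSpan-cong : ∀ {r} {W : Fin r → Col → Carrier} {v v′ : Col → Carrier} → v ≐ v′ → InSpan W v′ → InSpan W v
    InSpan-cong v≐v′ (κ , v′≐κ⊙W) = κ , λ col → trans (v≐v′ col) (v′≐κ⊙W col)

    InSpan-+ : ∀ {r} {W : Fin r → Col → Carrier} {v v′ : Col → Carrier} →
               InSpan W v → InSpan W v′ → InSpan W (λ col → v col + v′ col)
    InSpan-+ {W = W} (κ , v≐κ⊙W) (κ′ , v′≐κ′⊙W) = (λ k → κ k + κ′ k) , λ col →
      trans (+-cong (v≐κ⊙W col) (v′≐κ′⊙W col)) (sym (⊙-distribˡ κ κ′ W col))

    InSpan-scale : ∀ {r} {W : Fin r → Col → Carrier} {v : Col → Carrier} μ →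
                   InSpan W v → InSpan W (λ col → μ · v col)
    InSpan-scale {W = W} μ (κ , v≐κ⊙W) = (λ k → μ · κ k) , λ col →
      trans (*-congˡ (v≐κ⊙W col)) (sym (⊙-scaleˡ μ κ W col))

    InSpan-⊙ : ∀ {r s} {W : Fin r → Col → Carrier} {v : Fin s → Col → Carrier} (x : Fin s → Carrier) →
               (∀ u → InSpan W (v u)) → InSpan W (x ⊙ v)
    InSpan-⊙ {W = W} x v∈W = x ⊙ A , λ col → trans (⊙-cong (λ _ → refl) (λ u → proj₂ (v∈W u)) col) (⊙-assoc x A W col)
      where A = proj₁ ∘ v∈W

    InSpan-pad : ∀ {ρ q} → ρ ≤ q → (W : Fin ρ → Col → Carrier) →
                 Σ (Fin q → Col → Carrier) λ W′ → ∀ {v} → InSpan W v → InSpan W′ v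
    InSpan-pad {q = q} z≤n W = (λ _ → 0v) , λ (_ , v≐0) →
      (λ _ → 0#) , λ col → trans (v≐0 col) (sym (sum-zero {q} (λ _ → zeroˡ 0#)))
    InSpan-pad (s≤s ρ≤q) W = W zero ∷ W′ , λ (κ , v≐κ⊙W) →
      let (κ′ , tail≐κ′⊙W′) = embed (κ ∘ suc , λ _ → refl)
      in κ zero ∷ κ′ , λ col → trans (v≐κ⊙W col) (+-congˡ (tail≐κ′⊙W′ col))
      where
        W′ = proj₁ (InSpan-pad ρ≤q (W ∘ suc))
        embed = proj₂ (InSpan-pad ρ≤q (W ∘ suc))

    InSpan-concat : ∀ {r q} (W : Fin r → Fin q → Col → Carrier) (v : Fin r → Col → Carrier) →
                    (∀ t → InSpan (W t) (v t)) → InSpan (concat W) (λ col → ∑[ t < r ] v t col)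
    InSpan-concat {r} W v v∈W = concat κ , λ col → begin
      ∑[ t < r ] v t col           ≈⟨ sum-cong-≋ (λ t → proj₂ (v∈W t) col) ⟩
      ∑[ t < r ] (κ t ⊙ W t) col   ≈⟨ sum-concat (λ t k → κ t k · W t k col) ⟨
      (concat κ ⊙ concat W) col    ∎
      where κ = proj₁ ∘ v∈W

    dependent-of-span< : ∀ {r s} {w : Fin r → Col → Carrier} {v : Fin s → Col → Carrier} →
                         r < s → (∀ u → InSpan w (v u)) → ¬ ¬ Dependent v
    dependent-of-span< {w = w} {v} r<s v∈w = do
      (x , x⊙A≈0 , x≢0) ← dependent-of-dim< r<s (proj₁ ∘ v∈w)
      let x⊙v≈0 col = trans (proj₂ (InSpan-⊙ x v∈w) col) (sum-zero (λ t → trans (*-congʳ (x⊙A≈0 t)) (zeroˡ (w t col))))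
      pure (x , x⊙v≈0 , x≢0)

    independent⇒≤ : ∀ {r s} {w : Fin r → Col → Carrier} {v : Fin s → Col → Carrier} →
                    Independent v → (∀ u → InSpan w (v u)) → s ≤ r
    independent⇒≤ {r} {s} ind v∈w = decidable-stable (s ≤? r) λ s≰r →
      dependent-of-span< (ℕ.≰⇒> s≰r) v∈w (independent⇒¬dependent ind)

    independent-swap : ∀ {b} {Col′ : Set b} {s} {v : Fin s → Col × Col′ → Carrier} →
                       Independent v → Independent (λ u → v u ∘ swap)
    independent-swap ind x x⊙v≈0 = ind x (x⊙v≈0 ∘ swap)

    columns-in-span⇒≤ : ∀ {s m} {M : Fin s → Col → Carrier} {W : Fin m → Fin s → Carrier} →
                        Independent M → (∀ col → InSpan W (λ t → M t col)) → s ≤ m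
    columns-in-span⇒≤ {W = W} ind col∈W = independent⇒≤ {w = λ k col → proj₁ (col∈W col) k} ind λ t →
      (λ k → W k t) , λ col → trans (proj₂ (col∈W col) t) (sum-cong-≋ (λ k → *-comm _ (W k t)))

  module _ {n : ℕ} where

    ⟨⟩-comm : ∀ (φ v : Fin n → Carrier) → ⟨ φ , v ⟩ ≈ ⟨ v , φ ⟩
    ⟨⟩-comm φ v = sum-cong-≋ (λ c → *-comm (φ c) (v c))

    ⟨⟩-⊙ʳ : ∀ {r} (φ : Fin n → Carrier) (x : Fin r → Carrier) (v : Fin r → Fin n → Carrier) →
            ⟨ φ , x ⊙ v ⟩ ≈ ∑[ t < r ] (x t · ⟨ φ , v t ⟩)
    ⟨⟩-⊙ʳ {r} φ x v = begin
      ∑[ c < n ] (φ c · ∑[ t < r ] (x t · v t c))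
        ≈⟨ sum-cong-≋ (λ c → *-distribˡ-sum (φ c) (λ t → x t · v t c)) ⟩
      ∑[ c < n ] ∑[ t < r ] (φ c · (x t · v t c))
        ≈⟨ ∑-comm (λ c t → φ c · (x t · v t c)) ⟩
      ∑[ t < r ] ∑[ c < n ] (φ c · (x t · v t c))
        ≈⟨ sum-cong-≋ (λ t → sum-cong-≋ (λ c → ·-Props.x∙yz≈y∙xz (φ c) (x t) (v t c))) ⟩
      ∑[ t < r ] ∑[ c < n ] (x t · (φ c · v t c))
        ≈⟨ sum-cong-≋ (λ t → *-distribˡ-sum (x t) (λ c → φ c · v t c)) ⟨
      ∑[ t < r ] (x t · ⟨ φ , v t ⟩)
        ∎

    ⟨⟩-⊙ˡ : ∀ {r} (x : Fin r → Carrier) (ψ : Fin r → Fin n → Carrier) (v : Fin n → Carrier) →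
            ⟨ x ⊙ ψ , v ⟩ ≈ ∑[ t < r ] (x t · ⟨ ψ t , v ⟩)
    ⟨⟩-⊙ˡ x ψ v = trans (⟨⟩-comm (x ⊙ ψ) v)
      (trans (⟨⟩-⊙ʳ v x ψ) (sum-cong-≋ (λ t → *-congˡ (⟨⟩-comm v (ψ t)))))

    ⟨⟩-scaleʳ : ∀ (φ v : Fin n → Carrier) μ → ⟨ φ , (λ c → μ · v c) ⟩ ≈ μ · ⟨ φ , v ⟩
    ⟨⟩-scaleʳ φ v μ = ⊙-scaleʳ μ φ (λ c _ → v c) tt

    ⟨⟩-linearʳ : ∀ (φ v w : Fin n → Carrier) μ → ⟨ φ , (λ c → v c + μ · w c) ⟩ ≈ ⟨ φ , v ⟩ + μ · ⟨ φ , w ⟩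
    ⟨⟩-linearʳ φ v w μ = trans (⊙-distribʳ φ (λ c _ → v c) (λ c _ → μ · w c) tt) (+-congˡ (⟨⟩-scaleʳ φ w μ))

    ⟨⟩-linearˡ : ∀ (φ ψ v : Fin n → Carrier) μ → ⟨ (λ c → φ c + μ · ψ c) , v ⟩ ≈ ⟨ φ , v ⟩ + μ · ⟨ ψ , v ⟩
    ⟨⟩-linearˡ φ ψ v μ = trans (⊙-distribˡ φ (λ c → μ · ψ c) (λ c _ → v c) tt)
                               (+-congˡ (⊙-scaleˡ μ ψ (λ c _ → v c) tt))

    ⟨⟩-zeroʳ : ∀ φ {v : Fin n → Carrier} → v ≐ 0v → ⟨ φ , v ⟩ ≈ 0#
    ⟨⟩-zeroʳ φ v≈0 = sum-zero (λ c → trans (*-congˡ (v≈0 c)) (zeroʳ (φ c)))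

  Biorthogonal : ∀ {r n} → (Fin r → Fin n → Carrier) → (Fin r → Fin n → Carrier) → Set ℓ
  Biorthogonal ψ m = ∀ s t → ⟨ ψ s , m t ⟩ ≈ δ s t

  module _ {r n : ℕ} where

    biorthogonal⇒independent : ∀ {ψ m : Fin r → Fin n → Carrier} → Biorthogonal ψ m → Independent m
    biorthogonal⇒independent {ψ} {m} ψm≈δ x x⊙m≈0 s = begin
      x s                              ≈⟨ sum-δʳ s x ⟨
      ∑[ t < r ] (x t · δ t s)         ≈⟨ sum-cong-≋ (λ t → *-congˡ (trans (reflexive (δ-sym t s)) (sym (ψm≈δ s t)))) ⟩
      ∑[ t < r ] (x t · ⟨ ψ s , m t ⟩) ≈⟨ ⟨⟩-⊙ʳ (ψ s) x m ⟨
      ⟨ ψ s , x ⊙ m ⟩                  ≈⟨ ⟨⟩-zeroʳ (ψ s) x⊙m≈0 ⟩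
      0#                               ∎

    projection : (ψ m : Fin r → Fin n → Carrier) → (Fin n → Carrier) → Fin n → Carrier
    projection ψ m v = (λ t → ⟨ ψ t , v ⟩) ⊙ m

    residual : (ψ m : Fin r → Fin n → Carrier) → (Fin n → Carrier) → Fin n → Carrier
    residual ψ m v c = v c - projection ψ m v c

    projection-fixes : ∀ {ψ m : Fin r → Fin n → Carrier} → Biorthogonal ψ m → ∀ t → projection ψ m (m t) ≐ m t
    projection-fixes {ψ} {m} ψm≈δ t c = begin
      ∑[ s < r ] (⟨ ψ s , m t ⟩ · m s c) ≈⟨ sum-cong-≋ (λ s → *-congʳ (trans (ψm≈δ s t) (reflexive (δ-sym s t)))) ⟩
      ∑[ s < r ] (δ t s · m s c)         ≈⟨ sum-δˡ t (λ s → m s c) ⟩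
      m t c                              ∎

    extend-biorthogonal : ∀ {ψ m : Fin r → Fin n → Carrier} → Biorthogonal ψ m → (u : Fin n → Carrier) (q : Fin n) →
                          residual ψ m u q ≉ 0# →
                          Σ (Fin (suc r) → Fin n → Carrier) λ φ → Biorthogonal φ (u ∷ m)
    extend-biorthogonal {ψ} {m} ψm≈δ u q res≉0 = φ , φ-biorthogonal
      where
        ℓq : Fin n → Carrier
        ℓq c = δ q c - ((λ t → m t q) ⊙ ψ) c

        ⟨ℓq⟩ : ∀ v → ⟨ ℓq , v ⟩ ≈ residual ψ m v q
        ⟨ℓq⟩ v = begin
          ⟨ ℓq , v ⟩
            ≈⟨ sum-cong-≋ (λ c → [y-z]x≈yx-zx (v c) (δ q c) _) ⟩
          ∑[ c < n ] (δ q c · v c - ((λ t → m t q) ⊙ ψ) c · v c)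
            ≈⟨ sum-distrib-sub (λ c → δ q c · v c) (λ c → ((λ t → m t q) ⊙ ψ) c · v c) ⟩
          ⟨ δ q , v ⟩ - ⟨ (λ t → m t q) ⊙ ψ , v ⟩
            ≈⟨ +-cong (sum-δˡ q v) (-‿cong (⟨⟩-⊙ˡ (λ t → m t q) ψ v)) ⟩
          v q - ∑[ t < r ] (m t q · ⟨ ψ t , v ⟩)
            ≈⟨ +-congˡ (-‿cong (sum-cong-≋ (λ t → *-comm (m t q) _))) ⟩
          residual ψ m v q
            ∎

        α : Carrier
        α = proj₁ (inverse (residual ψ m u q) res≉0)

        φ₀ : Fin n → Carrier
        φ₀ c = α · ℓq c

        ⟨φ₀⟩ : ∀ v → ⟨ φ₀ , v ⟩ ≈ α · residual ψ m v q
        ⟨φ₀⟩ v = trans (⟨⟩-comm φ₀ v) (trans (⟨⟩-scaleʳ v ℓq α) (*-congˡ (trans (⟨⟩-comm v ℓq) (⟨ℓq⟩ v))))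

        ⟨φ₀,u⟩ : ⟨ φ₀ , u ⟩ ≈ 1#
        ⟨φ₀,u⟩ = trans (⟨φ₀⟩ u) (trans (*-comm α _) (proj₂ (inverse (residual ψ m u q) res≉0)))

        ⟨φ₀,m⟩ : ∀ t → ⟨ φ₀ , m t ⟩ ≈ 0#
        ⟨φ₀,m⟩ t = begin
          ⟨ φ₀ , m t ⟩                    ≈⟨ ⟨φ₀⟩ (m t) ⟩
          α · (m t q - projection ψ m (m t) q) ≈⟨ *-congˡ (+-congˡ (-‿cong (projection-fixes ψm≈δ t q))) ⟩
          α · (m t q - m t q)             ≈⟨ *-congˡ (-‿inverseʳ (m t q)) ⟩
          α · 0#                          ≈⟨ zeroʳ α ⟩
          0#                              ∎

        φ : Fin (suc r) → Fin n → Carrier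
        φ zero    = φ₀
        φ (suc s) c = ψ s c + (- ⟨ ψ s , u ⟩) · φ₀ c

        φ-biorthogonal : Biorthogonal φ (u ∷ m)
        φ-biorthogonal zero    zero    = ⟨φ₀,u⟩
        φ-biorthogonal zero    (suc t) = ⟨φ₀,m⟩ t
        φ-biorthogonal (suc s) zero    = begin
          ⟨ φ (suc s) , u ⟩
            ≈⟨ ⟨⟩-linearˡ (ψ s) φ₀ u _ ⟩
          ⟨ ψ s , u ⟩ + (- ⟨ ψ s , u ⟩) · ⟨ φ₀ , u ⟩
            ≈⟨ +-congˡ (trans (*-congˡ ⟨φ₀,u⟩) (*-identityʳ _)) ⟩
          ⟨ ψ s , u ⟩ + - ⟨ ψ s , u ⟩
            ≈⟨ -‿inverseʳ _ ⟩
          0#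
            ∎
        φ-biorthogonal (suc s) (suc t) = begin
          ⟨ φ (suc s) , m t ⟩
            ≈⟨ ⟨⟩-linearˡ (ψ s) φ₀ (m t) _ ⟩
          ⟨ ψ s , m t ⟩ + (- ⟨ ψ s , u ⟩) · ⟨ φ₀ , m t ⟩
            ≈⟨ +-cong (ψm≈δ s t) (trans (*-congˡ (⟨φ₀,m⟩ t)) (zeroʳ _)) ⟩
          δ s t + 0#
            ≈⟨ +-identityʳ _ ⟩
          δ s t
            ∎

  -- The dual vectors make the independence of the chosen rows constructive.
  record Basis {N n} (M : Fin N → Fin n → Carrier) : Set (c ⊔ ℓ) where
    field
      rank         : ℕ
      rows         : Fin rank → Fin N
      dual         : Fin rank → Fin n → Carrier
      coeff        : Fin N → Fin rank → Carrier
      biorthogonal : Biorthogonal dual (M ∘ rows)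
      spans        : ∀ u → M u ≐ coeff u ⊙ (M ∘ rows)

    independent : Independent (M ∘ rows)
    independent = biorthogonal⇒independent biorthogonal

    in-span : ∀ u → InSpan (M ∘ rows) (M u)
    in-span u = coeff u , spans u

  module _ {N n} {M : Fin (suc N) → Fin n → Carrier} (B : Basis (M ∘ suc)) where
    open Basis B

    extend-basis-in-span : residual dual (M ∘ suc ∘ rows) (M zero) ≐ 0v → Basis M
    extend-basis-in-span res≈0 = record
      { rank         = rank
      ; rows         = suc ∘ rows
      ; dual         = dual
      ; coeff        = (λ t → ⟨ dual t , M zero ⟩) ∷ coeff
      ; biorthogonal = biorthogonal
      ; spans        = λ { zero c → x∙y⁻¹≈ε⇒x≈y _ _ (res≈0 c) ; (suc u) → spans u }
      }

    extend-basis-outside-span : ∀ q → residual dual (M ∘ suc ∘ rows) (M zero) q ≉ 0# → Basis M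
    extend-basis-outside-span q res≉0 = record
      { rank         = suc rank
      ; rows         = rows′
      ; dual         = proj₁ extension
      ; coeff        = δ zero ∷ λ u → 0# ∷ coeff u
      ; biorthogonal = λ { s zero → proj₂ extension s zero ; s (suc t) → proj₂ extension s (suc t) }
      ; spans        = λ { zero c → sym (sum-δˡ zero (λ t → M (rows′ t) c))
                         ; (suc u) c → trans (spans u c) (sym (trans (+-congʳ (zeroˡ (M zero c))) (+-identityˡ _))) }
      }
      where
        rows′ : Fin (suc rank) → Fin (suc N)
        rows′ = zero ∷ suc ∘ rows
        extension = extend-biorthogonal biorthogonal (M zero) q res≉0

  basis-exists : ∀ {N n} (M : Fin N → Fin n → Carrier) → ¬ ¬ Basis M
  basis-exists {zero} M = pure record
    { rank = 0 ; rows = λ () ; dual = λ () ; coeff = λ () ; biorthogonal = λ () ; spans = λ () }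
  basis-exists {suc N} M = do
    B ← basis-exists (M ∘ suc)
    let open Basis B
    zero-or-nontrivial (residual dual (M ∘ suc ∘ rows) (M zero)) >>= λ where
      (inj₁ res≈0)       → pure (extend-basis-in-span B res≈0)
      (inj₂ (q , res≉0)) → pure (extend-basis-outside-span B q res≉0)

  module _ {a} {Col : Set a} {N : ℕ} (M : Fin N → Col → Carrier) where

    IndepRows⇒independent : ∀ {r f} → IndepRows F M r f → Independent (M ∘ f)
    IndepRows⇒independent {r} ind x x⊙M≈0 = ind x (λ col → trans (reflexive (∑≡sum r _)) (x⊙M≈0 col))

    independent⇒IndepRows : ∀ {r f} → Independent (M ∘ f) → IndepRows F M r f
    independent⇒IndepRows {r} ind x ∑≈0 = ind x (λ col → trans (reflexive (≡.sym (∑≡sum r _))) (∑≈0 col))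

  module _ {N n} {M : Fin N → Fin n → Carrier} (B : Basis M) where
    open Basis B

    rankAtLeast⇒≤rank : ∀ {s} → RankAtLeast F M s → s ≤ rank
    rankAtLeast⇒≤rank (f , ind) = independent⇒≤ (IndepRows⇒independent M ind) (in-span ∘ f)

    basis⇒isRank : IsRank F M rank
    basis⇒isRank = (rows , independent⇒IndepRows M independent) , λ _ → rankAtLeast⇒≤rank

    isRank⇒≡rank : ∀ {q} → IsRank F M q → q ≡ rank
    isRank⇒≡rank (atLeast , maximal) = ℕ.≤-antisym (rankAtLeast⇒≤rank atLeast) (maximal rank (proj₁ basis⇒isRank))

  _ᵀ : ∀ {N n} → (Fin N → Fin n → Carrier) → Fin n → Fin N → Carrier
  (M ᵀ) c u = M u c

  rank-transpose≤ : ∀ {N n} {M : Fin N → Fin n → Carrier} (B : Basis M) (Bᵀ : Basis (M ᵀ)) →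
                    Basis.rank Bᵀ ≤ Basis.rank B
  rank-transpose≤ B Bᵀ = columns-in-span⇒≤ (Basis.independent Bᵀ) λ u → coeff u , λ s → spans u (Basis.rows Bᵀ s)
    where open Basis B

  module _ {N n} {M : Fin N → Fin n → Carrier} where

    rank-transpose : (B : Basis M) (Bᵀ : Basis (M ᵀ)) → Basis.rank Bᵀ ≡ Basis.rank B
    rank-transpose B Bᵀ = ℕ.≤-antisym (rank-transpose≤ B Bᵀ) (rank-transpose≤ Bᵀ B)

    isRank-transpose : ∀ {q} → IsRank F (M ᵀ) q → ¬ ¬ IsRank F M q
    isRank-transpose isRankᵀ = do
      B  ← basis-exists M
      Bᵀ ← basis-exists (M ᵀ)
      pure (≡.subst (IsRank F M) (≡.sym (≡.trans (isRank⇒≡rank Bᵀ isRankᵀ) (rank-transpose B Bᵀ))) (basis⇒isRank B))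

  MaximalRank : ∀ {x} {X : Set x} {N n} → (X → Fin N → Fin n → Carrier) → ℕ → Set (x ⊔ c ⊔ ℓ)
  MaximalRank {X = X} M q = Σ X (λ x → IsRank F (M x) q) × (∀ x r → IsRank F (M x) r → r ≤ q)

  module _ {x} {X : Set x} {N n} {M : X → Fin N → Fin n → Carrier} where

    maximalRank⇒bound : ∀ {q} → MaximalRank M q → ∀ x (B : Basis (M x)) → Basis.rank B ≤ q
    maximalRank⇒bound (_ , maximal) x B = maximal x (Basis.rank B) (basis⇒isRank B)

    maximalRank⇒attained : ∀ {q} → MaximalRank M q → ¬ ¬ (Σ X λ x → Σ (Basis (M x)) λ B → Basis.rank B ≡ q)
    maximalRank⇒attained ((x , isRank) , _) = do
      B ← basis-exists (M x)
      pure (x , B , ≡.sym (isRank⇒≡rank B isRank))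

    maximalRank-transpose : ∀ {q} → MaximalRank (λ x → M x ᵀ) q → ¬ ¬ MaximalRank M q
    maximalRank-transpose {q} ((x , isRankᵀ) , maximalᵀ) = do
      isRank ← isRank-transpose {M = M x} isRankᵀ
      pure ((x , isRank) , λ x′ r isRank′ →
        decidable-stable (r ≤? q) (λ r≰q → isRank-transpose {M = M x′ ᵀ} isRank′ (r≰q ∘ maximalᵀ x′ r)))

  independent⇒≤dim : ∀ {s n} {v : Fin s → Fin n → Carrier} → Independent v → s ≤ n
  independent⇒≤dim {v = v} ind = independent⇒≤ ind (λ u → v u , λ c → sym (sum-δʳ c (v u)))

  Eigenvector : ∀ {r} → (Fin r → Fin r → Carrier) → Carrier → (Fin r → Carrier) → Set ℓ
  Eigenvector B ν α = (∀ s → ⟨ B s , α ⟩ ≈ ν · α s) × Nontrivial α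

  eigenvectors-independent : ∀ {r k} (B : Fin r → Fin r → Carrier) {λs : Fin k → Carrier} {α : Fin k → Fin r → Carrier} →
                             (∀ i j → λs i ≈ λs j → i ≡ j) → (∀ i → Eigenvector B (λs i) (α i)) → Independent α
  eigenvectors-independent {r} {suc k} B {λs} {α} λs-injective eigen x x⊙α≈0 = x≈0
    where
      image-relation : (λ i → x i · λs i) ⊙ α ≐ 0v
      image-relation s = begin
        ∑[ i < suc k ] ((x i · λs i) · α i s)
          ≈⟨ sum-cong-≋ (λ i → trans (*-assoc (x i) (λs i) (α i s)) (*-congˡ (sym (proj₁ (eigen i) s)))) ⟩
        ∑[ i < suc k ] (x i · ⟨ B s , α i ⟩)
          ≈⟨ ⟨⟩-⊙ʳ (B s) x α ⟨
        ⟨ B s , x ⊙ α ⟩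
          ≈⟨ ⟨⟩-zeroʳ (B s) x⊙α≈0 ⟩
        0#
          ∎

      y : Fin (suc k) → Carrier
      y i = x i · (λs i - λs zero)

      y-relation : y ⊙ α ≐ 0v
      y-relation s = begin
        ∑[ i < suc k ] (y i · α i s)
          ≈⟨ sum-cong-≋ (λ i → trans (*-congʳ (x[y-z]≈xy-xz (x i) (λs i) (λs zero))) ([y-z]x≈yx-zx (α i s) _ _)) ⟩
        ∑[ i < suc k ] ((x i · λs i) · α i s - (x i · λs zero) · α i s)
          ≈⟨ sum-distrib-sub (λ i → (x i · λs i) · α i s) (λ i → (x i · λs zero) · α i s) ⟩
        ((λ i → x i · λs i) ⊙ α) s - ∑[ i < suc k ] ((x i · λs zero) · α i s)
          ≈⟨ +-cong (image-relation s) (-‿cong (sum-cong-≋ (λ i → ·-Props.xy∙z≈y∙xz (x i) (λs zero) (α i s)))) ⟩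
        0# - ∑[ i < suc k ] (λs zero · (x i · α i s))
          ≈⟨ +-congˡ (-‿cong (*-distribˡ-sum (λs zero) (λ i → x i · α i s))) ⟨
        0# - λs zero · (x ⊙ α) s
          ≈⟨ +-congˡ (-‿cong (trans (*-congˡ (x⊙α≈0 s)) (zeroʳ _))) ⟩
        0# - 0#
          ≈⟨ -‿inverseʳ 0# ⟩
        0#
          ∎

      tail-relation : (y ∘ suc) ⊙ (α ∘ suc) ≐ 0v
      tail-relation s = begin
        ((y ∘ suc) ⊙ (α ∘ suc)) s
          ≈⟨ +-identityˡ _ ⟨
        0# + ((y ∘ suc) ⊙ (α ∘ suc)) s
          ≈⟨ +-congʳ (trans (*-congʳ (trans (*-congˡ (-‿inverseʳ (λs zero))) (zeroʳ (x zero)))) (zeroˡ (α zero s))) ⟨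
        (y ⊙ α) s
          ≈⟨ y-relation s ⟩
        0#
          ∎

      x-tail≈0 : ∀ i → x (suc i) ≈ 0#
      x-tail≈0 i = x·y≈0⇒x≈0
        (eigenvectors-independent B (λ i j e → Fin.suc-injective (λs-injective (suc i) (suc j) e)) (eigen ∘ suc) (y ∘ suc) tail-relation i)
        (λ λ≈λ₀ → Fin.0≢1+n (≡.sym (λs-injective (suc i) zero (x∙y⁻¹≈ε⇒x≈y _ _ λ≈λ₀))))

      x-head≈0 : x zero ≈ 0#
      x-head≈0 = x·y≈0⇒x≈0 (begin
        x zero · α zero j                           ≈⟨ +-identityʳ _ ⟨
        x zero · α zero j + 0#                      ≈⟨ +-congˡ (sum-zero (λ i → trans (*-congʳ (x-tail≈0 i)) (zeroˡ _))) ⟨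
        (x ⊙ α) j                                   ≈⟨ x⊙α≈0 j ⟩
        0#                                          ∎) αj≉0
        where
          j = proj₁ (proj₂ (eigen zero))
          αj≉0 = proj₂ (proj₂ (eigen zero))

      x≈0 : ∀ i → x i ≈ 0#
      x≈0 zero    = x-head≈0
      x≈0 (suc i) = x-tail≈0 i

  ¬suc-dim-distinct-eigenvalues : ∀ {r} (B : Fin r → Fin r → Carrier) (λs : Fin (suc r) → Carrier) →
                     (∀ i j → λs i ≈ λs j → i ≡ j) → ¬ (∀ i → Σ _ (Eigenvector B (λs i)))
  ¬suc-dim-distinct-eigenvalues B λs λs-injective eigen = ℕ.1+n≰n
    (independent⇒≤dim {v = proj₁ ∘ eigen} (eigenvectors-independent B λs-injective (proj₂ ∘ eigen)))

  solve-linear : ∀ {a μ μ⁻¹ X} → a + μ · X ≈ 0# → μ · μ⁻¹ ≈ 1# → X ≈ (- μ⁻¹) · a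
  solve-linear {a} {μ} {μ⁻¹} {X} a+μX≈0 μμ⁻¹≈1 = begin
    X               ≈⟨ *-identityˡ X ⟨
    1# · X          ≈⟨ *-congʳ (trans (*-comm μ⁻¹ μ) μμ⁻¹≈1) ⟨
    (μ⁻¹ · μ) · X   ≈⟨ *-assoc μ⁻¹ μ X ⟩
    μ⁻¹ · (μ · X)   ≈⟨ *-congˡ (+-inverseʳ-unique a (μ · X) a+μX≈0) ⟩
    μ⁻¹ · (- a)     ≈⟨ -‿distribʳ-* μ⁻¹ a ⟨
    - (μ⁻¹ · a)     ≈⟨ -‿distribˡ-* μ⁻¹ a ⟩
    (- μ⁻¹) · a     ∎

  inverse-injective : ∀ {x x⁻¹ y y⁻¹} → x · x⁻¹ ≈ 1# → y · y⁻¹ ≈ 1# → x⁻¹ ≈ y⁻¹ → x ≈ y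
  inverse-injective {x} {x⁻¹} {y} {y⁻¹} xx⁻¹≈1 yy⁻¹≈1 x⁻¹≈y⁻¹ = begin
    x                ≈⟨ *-identityʳ x ⟨
    x · 1#           ≈⟨ *-congˡ (trans (*-congˡ x⁻¹≈y⁻¹) yy⁻¹≈1) ⟨
    x · (y · x⁻¹)    ≈⟨ ·-Props.x∙yz≈y∙xz x y x⁻¹ ⟩
    y · (x · x⁻¹)    ≈⟨ trans (*-congˡ xx⁻¹≈1) (*-identityʳ y) ⟩
    y                ∎

  distinct-nonzero-scalars : ∀ {r n} → CardGreaterThan F n → r < n →
    Σ (Fin (suc r) → Carrier) λ μ → (∀ i → μ i ≉ 0#) × (∀ i j → μ i ≈ μ j → i ≡ j)
  distinct-nonzero-scalars (e , e-injective) r<n = μ , μ≉0 , μ-injective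
    where
      μ : Fin _ → Carrier
      μ i = e (suc (Fin.inject≤ i r<n)) - e zero

      μ≉0 : ∀ i → μ i ≉ 0#
      μ≉0 i μi≈0 with e-injective _ _ (x∙y⁻¹≈ε⇒x≈y _ _ μi≈0)
      ... | ()

      μ-injective : ∀ i j → μ i ≈ μ j → i ≡ j
      μ-injective i j μi≈μj = Fin.inject≤-injective r<n r<n i j
        (Fin.suc-injective (e-injective _ _ (+-cancelʳ (- e zero) _ _ μi≈μj)))

  -- In the coordinates given by φ, the basis dual to u ∷ m, the tail of a dependence among the
  -- vectors perturbed μ lies in the kernel of 1 + μ B, i.e. is an eigenvector of B for -μ⁻¹.
  module Perturbation {r n} {ψ m : Fin r → Fin n → Carrier} (ψm≈δ : Biorthogonal ψ m)
                      (u : Fin n → Carrier) (q : Fin n) (res≉0 : residual ψ m u q ≉ 0#)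
                      (p : Fin r → Fin n → Carrier) where

    private
      φ : Fin (suc r) → Fin n → Carrier
      φ = proj₁ (extend-biorthogonal ψm≈δ u q res≉0)

      φ-biorthogonal : Biorthogonal φ (u ∷ m)
      φ-biorthogonal = proj₂ (extend-biorthogonal ψm≈δ u q res≉0)

      B : Fin r → Fin r → Carrier
      B s t = ⟨ φ (suc s) , p t ⟩

    perturbed : Carrier → Fin (suc r) → Fin n → Carrier
    perturbed μ = (λ c → μ · u c) ∷ (λ t c → m t c + μ · p t c)

    r<n : r < n
    r<n = independent⇒≤dim {v = u ∷ m} (biorthogonal⇒independent φ-biorthogonal)

    private
      coordinate : ∀ {μ γ} → γ ⊙ perturbed μ ≐ 0v → ∀ s →
                   γ zero · (μ · δ s zero) + ∑[ t < r ] (γ (suc t) · (δ s (suc t) + μ · ⟨ φ s , p t ⟩)) ≈ 0#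
      coordinate {μ} {γ} γ⊙perturbed≈0 s = begin
        γ zero · (μ · δ s zero) + ∑[ t < r ] (γ (suc t) · (δ s (suc t) + μ · ⟨ φ s , p t ⟩))
          ≈⟨ +-cong (*-congˡ (trans (⟨⟩-scaleʳ (φ s) u μ) (*-congˡ (φ-biorthogonal s zero))))
                    (sum-cong-≋ (λ t → *-congˡ (trans (⟨⟩-linearʳ (φ s) (m t) (p t) μ) (+-congʳ (φ-biorthogonal s (suc t)))))) ⟨
        ∑[ j < suc r ] (γ j · ⟨ φ s , perturbed μ j ⟩)
          ≈⟨ ⟨⟩-⊙ʳ (φ s) γ (perturbed μ) ⟨
        ⟨ φ s , γ ⊙ perturbed μ ⟩
          ≈⟨ ⟨⟩-zeroʳ (φ s) γ⊙perturbed≈0 ⟩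
        0#  ∎

      kernel-equation : ∀ {μ γ} → γ ⊙ perturbed μ ≐ 0v → ∀ s → γ (suc s) + μ · ⟨ B s , γ ∘ suc ⟩ ≈ 0#
      kernel-equation {μ} {γ} γ⊙perturbed≈0 s = begin
        α s + μ · ⟨ B s , α ⟩
          ≈⟨ +-cong (sym (sum-δʳ s α)) (*-congˡ (⟨⟩-comm (B s) α)) ⟩
        ∑[ t < r ] (α t · δ t s) + μ · ∑[ t < r ] (α t · B s t)
          ≈⟨ +-cong (sum-cong-≋ (λ t → *-congˡ (reflexive (δ-sym t s)))) (*-distribˡ-sum μ (λ t → α t · B s t)) ⟩
        ∑[ t < r ] (α t · δ s t) + ∑[ t < r ] (μ · (α t · B s t))
          ≈⟨ ∑-distrib-+ (λ t → α t · δ s t) (λ t → μ · (α t · B s t)) ⟨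
        ∑[ t < r ] (α t · δ s t + μ · (α t · B s t))
          ≈⟨ sum-cong-≋ (λ t → trans (+-congˡ (·-Props.x∙yz≈y∙xz μ (α t) (B s t))) (sym (distribˡ (α t) _ _))) ⟩
        ∑[ t < r ] (α t · (δ s t + μ · B s t))
          ≈⟨ +-identityˡ _ ⟨
        0# + ∑[ t < r ] (α t · (δ s t + μ · B s t))
          ≈⟨ +-congʳ (trans (*-congˡ (zeroʳ μ)) (zeroʳ (γ zero))) ⟨
        γ zero · (μ · 0#) + ∑[ t < r ] (α t · (δ s t + μ · B s t))
          ≈⟨ coordinate {μ} {γ} γ⊙perturbed≈0 (suc s) ⟩
        0#  ∎
        where α = γ ∘ suc

      kernel-nontrivial : ∀ {μ γ} → μ ≉ 0# → γ ⊙ perturbed μ ≐ 0v → Nontrivial γ → ¬ ¬ Nontrivial (γ ∘ suc)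
      kernel-nontrivial {μ} {γ} μ≉0 γ⊙perturbed≈0 (zero , γ₀≉0) = zero-or-nontrivial (γ ∘ suc) >>= λ where
        (inj₂ α≢0) → pure α≢0
        (inj₁ α≈0) → λ _ → γ₀≉0 (x·y≈0⇒x≈0 (begin
          γ zero · (μ · 1#)
            ≈⟨ +-identityʳ _ ⟨
          γ zero · (μ · 1#) + 0#
            ≈⟨ +-congˡ (sum-zero (λ t → trans (*-congʳ (α≈0 t)) (zeroˡ _))) ⟨
          γ zero · (μ · 1#) + ∑[ t < r ] (γ (suc t) · (0# + μ · ⟨ φ zero , p t ⟩))
            ≈⟨ coordinate {μ} {γ} γ⊙perturbed≈0 zero ⟩
          0#  ∎) (λ μ1≈0 → μ≉0 (trans (sym (*-identityʳ μ)) μ1≈0)))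
      kernel-nontrivial μ≉0 _ (suc t , γt≉0) = pure (t , γt≉0)

      dependent⇒eigenvector : ∀ {μ} (μ≉0 : μ ≉ 0#) → Dependent (perturbed μ) →
                              ¬ ¬ Σ _ (Eigenvector B (- proj₁ (inverse μ μ≉0)))
      dependent⇒eigenvector {μ} μ≉0 (γ , γ⊙perturbed≈0 , γ≢0) = do
        α≢0 ← kernel-nontrivial {μ} {γ} μ≉0 γ⊙perturbed≈0 γ≢0
        pure (γ ∘ suc , (λ s → solve-linear (kernel-equation {μ} {γ} γ⊙perturbed≈0 s) (proj₂ (inverse μ μ≉0))) , α≢0)

    not-all-dependent : (μ : Fin (suc r) → Carrier) (μ≉0 : ∀ i → μ i ≉ 0#) →
                        (∀ i j → μ i ≈ μ j → i ≡ j) → ¬ (∀ i → Dependent (perturbed (μ i)))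
    not-all-dependent μ μ≉0 μ-injective dependent = ¬¬-Π-Fin (suc r) (λ i → dependent⇒eigenvector (μ≉0 i) (dependent i))
      (¬suc-dim-distinct-eigenvalues B ν ν-injective)
      where
        ν : Fin (suc r) → Carrier
        ν i = - proj₁ (inverse (μ i) (μ≉0 i))

        ν-injective : ∀ i j → ν i ≈ ν j → i ≡ j
        ν-injective i j νi≈νj = μ-injective i j
          (inverse-injective (proj₂ (inverse (μ i) (μ≉0 i))) (proj₂ (inverse (μ j) (μ≉0 j))) (-‿injective νi≈νj))

module Tensor {c ℓ} (F : Field c ℓ) {nI nJ nK : ℕ} (Z : Fin nI → Fin nJ → Fin nK → Field.Carrier F) where

  open LinearAlgebra F public

  -- Written with the ∑ of Defs so that, when Z reorders the factors of T, P and R are literally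
  -- sliceComb of T or its transpose.
  P : (Fin nI → Carrier) → Fin nJ → Fin nK → Carrier
  P x b c = ∑ F nI (λ a → x a · Z a b c)

  R : (Fin nJ → Carrier) → Fin nI → Fin nK → Carrier
  R y a c = ∑ F nJ (λ b → y b · Z a b c)

  P≐⊙ : ∀ x b → P x b ≐ x ⊙ (λ a → Z a b)
  P≐⊙ x b c = reflexive (∑≡sum nI _)

  R≐⊙ : ∀ y a → R y a ≐ y ⊙ Z a
  R≐⊙ y a c = reflexive (∑≡sum nJ _)

  P-linear : ∀ x₀ x μ b → P (λ a → x₀ a + μ · x a) b ≐ λ c → P x₀ b c + μ · P x b c
  P-linear x₀ x μ b c = begin
    P (λ a → x₀ a + μ · x a) b c
      ≈⟨ P≐⊙ _ b c ⟩
    ((λ a → x₀ a + μ · x a) ⊙ (λ a → Z a b)) c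
      ≈⟨ ⊙-distribˡ x₀ (λ a → μ · x a) (λ a → Z a b) c ⟩
    (x₀ ⊙ (λ a → Z a b)) c + ((λ a → μ · x a) ⊙ (λ a → Z a b)) c
      ≈⟨ +-congˡ (⊙-scaleˡ μ x (λ a → Z a b) c) ⟩
    (x₀ ⊙ (λ a → Z a b)) c + μ · (x ⊙ (λ a → Z a b)) c
      ≈⟨ +-cong (P≐⊙ x₀ b c) (*-congˡ (P≐⊙ x b c)) ⟨
    P x₀ b c + μ · P x b c
      ∎

  fibre≐P : ∀ a b → Z a b ≐ P (δ a) b
  fibre≐P a b c = sym (trans (P≐⊙ (δ a) b c) (δ-⊙ a (λ a′ → Z a′ b) c))

  fibre≐R : ∀ a b → Z a b ≐ R (δ b) a
  fibre≐R a b c = sym (trans (R≐⊙ (δ b) a c) (δ-⊙ b (Z a) c))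

  module _ (card : CardGreaterThan F nK) {x₀} (B₀ : Basis (P x₀))
           (P-maximal : ∀ x (B : Basis (P x)) → Basis.rank B ≤ Basis.rank B₀) where
    open Basis B₀

    compression : ∀ z → z ⊙ P x₀ ≐ 0v → ∀ x → ¬ ¬ InSpan (P x₀ ∘ rows) (z ⊙ P x)
    compression z z⊙P₀≈0 x = zero-or-nontrivial (residual dual (P x₀ ∘ rows) u) >>= by-residual
      where
        u : Fin nK → Carrier
        u = z ⊙ P x

        xμ : Carrier → Fin nI → Carrier
        xμ μ a = x₀ a + μ · x a

        z⊙Pμ≐μu : ∀ μ → z ⊙ P (xμ μ) ≐ λ c → μ · u c
        z⊙Pμ≐μu μ c = begin
          (z ⊙ P (xμ μ)) c                                       ≈⟨ ⊙-cong (λ _ → refl) (P-linear x₀ x μ) c ⟩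
          (z ⊙ (λ b c → P x₀ b c + μ · P x b c)) c               ≈⟨ ⊙-distribʳ z (P x₀) (λ b c → μ · P x b c) c ⟩
          (z ⊙ P x₀) c + (z ⊙ (λ b c → μ · P x b c)) c           ≈⟨ +-cong (z⊙P₀≈0 c) (⊙-scaleʳ μ z (P x) c) ⟩
          0# + μ · u c                                           ≈⟨ +-identityˡ _ ⟩
          μ · u c                                                ∎

        module _ {q} (res≉0 : residual dual (P x₀ ∘ rows) u q ≉ 0#) where
          open Perturbation biorthogonal u q res≉0 (P x ∘ rows)

          perturbed∈rowspace : ∀ μ (Bμ : Basis (P (xμ μ))) j → InSpan (P (xμ μ) ∘ Basis.rows Bμ) (perturbed μ j)
          perturbed∈rowspace μ Bμ zero    = InSpan-cong (λ c → sym (z⊙Pμ≐μu μ c)) (InSpan-⊙ z (Basis.in-span Bμ))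
          perturbed∈rowspace μ Bμ (suc t) = InSpan-cong (λ c → sym (P-linear x₀ x μ (rows t) c)) (Basis.in-span Bμ (rows t))

          perturbed-dependent : ∀ μ → ¬ ¬ Dependent (perturbed μ)
          perturbed-dependent μ = basis-exists (P (xμ μ)) >>= λ Bμ →
            dependent-of-span< (s≤s (P-maximal (xμ μ) Bμ)) (perturbed∈rowspace μ Bμ)

          outside-span-impossible : ⊥
          outside-span-impossible =
            let (μ , μ≉0 , μ-injective) = distinct-nonzero-scalars card r<n
            in ¬¬-Π-Fin _ (perturbed-dependent ∘ μ) (not-all-dependent μ μ≉0 μ-injective)

        by-residual : (residual dual (P x₀ ∘ rows) u ≐ 0v) ⊎ Nontrivial (residual dual (P x₀ ∘ rows) u) →
                      ¬ ¬ InSpan (P x₀ ∘ rows) u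
        by-residual (inj₁ res≈0)       = pure ((λ t → ⟨ dual t , u ⟩) , λ c → x∙y⁻¹≈ε⇒x≈y _ _ (res≈0 c))
        by-residual (inj₂ (q , res≉0)) = ⊥-elim (outside-span-impossible res≉0)

    kernel-vector : Fin nJ → Fin nJ → Carrier
    kernel-vector b b′ = δ b b′ - (coeff b ⊙ (δ ∘ rows)) b′

    kernel-vector-⊙ : ∀ b (Q : Fin nJ → Fin nK → Carrier) →
                      kernel-vector b ⊙ Q ≐ λ c → Q b c - (coeff b ⊙ (Q ∘ rows)) c
    kernel-vector-⊙ b Q c = begin
      ∑[ b′ < nJ ] ((δ b b′ - (coeff b ⊙ (δ ∘ rows)) b′) · Q b′ c)
        ≈⟨ sum-cong-≋ (λ b′ → [y-z]x≈yx-zx (Q b′ c) (δ b b′) _) ⟩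
      ∑[ b′ < nJ ] (δ b b′ · Q b′ c - (coeff b ⊙ (δ ∘ rows)) b′ · Q b′ c)
        ≈⟨ sum-distrib-sub (λ b′ → δ b b′ · Q b′ c) (λ b′ → (coeff b ⊙ (δ ∘ rows)) b′ · Q b′ c) ⟩
      (δ b ⊙ Q) c - ((coeff b ⊙ (δ ∘ rows)) ⊙ Q) c
        ≈⟨ +-congˡ (-‿cong (⊙-assoc (coeff b) (δ ∘ rows) Q c)) ⟨
      (δ b ⊙ Q) c - (coeff b ⊙ (λ t → δ (rows t) ⊙ Q)) c
        ≈⟨ +-cong (δ-⊙ b Q c) (-‿cong (⊙-cong (λ _ → refl) (λ t → δ-⊙ (rows t) Q) c)) ⟩
      Q b c - (coeff b ⊙ (Q ∘ rows)) c
        ∎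

    kernel-vector-annihilates : ∀ b → kernel-vector b ⊙ P x₀ ≐ 0v
    kernel-vector-annihilates b c = trans (kernel-vector-⊙ b (P x₀) c) (x≈y⇒x∙y⁻¹≈ε (spans b c))

    fibre-decomposition : ∀ a b → (k : InSpan (P x₀ ∘ rows) (kernel-vector b ⊙ P (δ a))) →
      Z a b ≐ λ c → ∑[ t < rank ] (proj₁ k t · P x₀ (rows t) c + coeff b t · Z a (rows t) c)
    fibre-decomposition a b (k , kernel-part≐) c = begin
      Z a b c
        ≈⟨ fibre≐P a b c ⟩
      P (δ a) b c
        ≈⟨ x-y+y≈x (P (δ a) b c) _ ⟨
      (P (δ a) b c - (coeff b ⊙ (P (δ a) ∘ rows)) c) + (coeff b ⊙ (P (δ a) ∘ rows)) c
        ≈⟨ +-cong (kernel-vector-⊙ b (P (δ a)) c) (⊙-cong (λ _ → refl) (λ t → fibre≐P a (rows t)) c) ⟨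
      (kernel-vector b ⊙ P (δ a)) c + (coeff b ⊙ (Z a ∘ rows)) c
        ≈⟨ +-congʳ (kernel-part≐ c) ⟩
      (k ⊙ (P x₀ ∘ rows)) c + (coeff b ⊙ (Z a ∘ rows)) c
        ≈⟨ ∑-distrib-+ (λ t → k t · P x₀ (rows t) c) (λ t → coeff b t · Z a (rows t) c) ⟨
      ∑[ t < rank ] (k t · P x₀ (rows t) c + coeff b t · Z a (rows t) c)
        ∎

    module _ {qj} (R-bound : ∀ y (B : Basis (R y)) → Basis.rank B ≤ qj) (BR : ∀ t → Basis (R (δ (rows t)))) where

      block-span : Fin rank → Fin qj → Fin nK → Carrier
      block-span t = proj₁ (InSpan-pad (R-bound _ (BR t)) (R (δ (rows t)) ∘ Basis.rows (BR t)))

      fibre∈block-span : ∀ t a → InSpan (block-span t) (Z a (rows t))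
      fibre∈block-span t a = proj₂ (InSpan-pad (R-bound _ (BR t)) (R (δ (rows t)) ∘ Basis.rows (BR t)))
        (InSpan-cong (fibre≐R a (rows t)) (Basis.in-span (BR t) a))

      fibre∈concat : ∀ a b → InSpan (P x₀ ∘ rows) (kernel-vector b ⊙ P (δ a)) → InSpan (concat block-span) (Z a b)
      fibre∈concat a b k = InSpan-cong (fibre-decomposition a b k) (InSpan-concat block-span _ λ t →
        InSpan-+ (InSpan-scale (proj₁ k t) (InSpan-cong (P≐⊙ x₀ (rows t)) (InSpan-⊙ x₀ (λ a′ → fibre∈block-span t a′))))
                 (InSpan-scale (coeff b t) (fibre∈block-span t a)))

    fibres-spanned : ∀ {qj} → (∀ y (B : Basis (R y)) → Basis.rank B ≤ qj) →
                     ¬ ¬ Σ (Fin (rank * qj) → Fin nK → Carrier) λ W → ∀ a b → InSpan W (Z a b)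
    fibres-spanned R-bound = do
      BR ← ¬¬-Π-Fin rank (λ t → basis-exists (R (δ (rows t))))
      k  ← ¬¬-Π-Fin nI λ a → ¬¬-Π-Fin nJ λ b → compression (kernel-vector b) (kernel-vector-annihilates b) (δ a)
      pure (concat (block-span R-bound BR) , λ a b → fibre∈concat R-bound BR a b (k a b))

  ConciseAlongK : Set _
  ConciseAlongK = Σ (Fin nK → Fin nK) λ f → Independent (λ t (ab : Fin nI × Fin nJ) → Z (proj₁ ab) (proj₂ ab) (f t))

  dimK≤maxRank-product : CardGreaterThan F nK → ConciseAlongK →
              ∀ {qi qj} → ¬ ¬ MaximalRank P qi → ¬ ¬ MaximalRank R qj → nK ≤ qi * qj
  dimK≤maxRank-product card (f , concise) {qi} {qj} ¬¬P-max ¬¬R-max = decidable-stable (nK ≤? qi * qj) do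
    P-max ← ¬¬P-max
    R-max ← ¬¬R-max
    (x₀ , B₀ , rank≡qi) ← maximalRank⇒attained P-max
    let P-maximal x B = ≡.subst (Basis.rank B ≤_) (≡.sym rank≡qi) (maximalRank⇒bound P-max x B)
    (W , fibre∈W) ← fibres-spanned card B₀ P-maximal (maximalRank⇒bound R-max)
    pure (≡.subst (λ r → nK ≤ r * qj) rank≡qi
      (columns-in-span⇒≤ concise λ (a , b) → proj₁ (fibre∈W a b) , λ t → proj₂ (fibre∈W a b) (f t)))

flattening-independent : ∀ {c ℓ} (F : Field c ℓ) {n₁ n₂ n₃} {T : Tensor F n₁ n₂ n₃} → Concise F T → ∀ l →
  Σ (Fin (dim F l) → Fin (dim F l)) λ f → LinearAlgebra.Independent F (flattening F T l ∘ f)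
flattening-independent F {T = T} concise l =
  map₂ (LinearAlgebra.IndepRows⇒independent F (flattening F T l)) (proj₁ (concise l))

theorem2p1 : {c ℓ : Level} (F : Field c ℓ) (n₁ n₂ n₃ : ℕ) (T : Tensor F n₁ n₂ n₃) →
    Concise F {n₁} {n₂} {n₃} T →
    (i j k : Fin 3) → i ≢ j → j ≢ k → i ≢ k →
    CardGreaterThan F (dim F {n₁} {n₂} {n₃} k) →
    (qi qj : ℕ) → IsQ F T i qi → IsQ F T j qj →
    dim F {n₁} {n₂} {n₃} k ≤ qi * qj
theorem2p1 F _ _ _ T concise 0F 1F 2F _ _ _ card _ _ Qi Qj =
  dimK≤maxRank-product card (flattening-independent F concise 2F)
    (pure Qi) (pure Qj)
  where open Tensor F (λ a b c → T a b c)
theorem2p1 F _ _ _ T concise 1F 0F 2F _ _ _ card _ _ Qi Qj =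
  dimK≤maxRank-product card (map₂ independent-swap (flattening-independent F concise 2F))
    (pure Qi) (pure Qj)
  where open Tensor F (λ a b c → T b a c)
theorem2p1 F _ _ _ T concise 0F 2F 1F _ _ _ card _ _ Qi Qj =
  dimK≤maxRank-product card (flattening-independent F concise 1F)
    (maximalRank-transpose {M = P} Qi) (pure Qj)
  where open Tensor F (λ a b c → T a c b)
theorem2p1 F _ _ _ T concise 2F 0F 1F _ _ _ card _ _ Qi Qj =
  dimK≤maxRank-product card (map₂ independent-swap (flattening-independent F concise 1F))
    (pure Qi) (maximalRank-transpose {M = R} Qj)
  where open Tensor F (λ a b c → T b c a)
theorem2p1 F _ _ _ T concise 1F 2F 0F _ _ _ card _ _ Qi Qj =
  dimK≤maxRank-product card (flattening-independent F concise 0F)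
    (maximalRank-transpose {M = P} Qi) (maximalRank-transpose {M = R} Qj)
  where open Tensor F (λ a b c → T c a b)
theorem2p1 F _ _ _ T concise 2F 1F 0F _ _ _ card _ _ Qi Qj =
  dimK≤maxRank-product card (map₂ independent-swap (flattening-independent F concise 0F))
    (maximalRank-transpose {M = P} Qi) (maximalRank-transpose {M = R} Qj)
  where open Tensor F (λ a b c → T c b a)
theorem2p1 _ _ _ _ _ _ 0F 0F _ i≢j _ _ = contradiction ≡.refl i≢j
theorem2p1 _ _ _ _ _ _ 1F 1F _ i≢j _ _ = contradiction ≡.refl i≢j
theorem2p1 _ _ _ _ _ _ 2F 2F _ i≢j _ _ = contradiction ≡.refl i≢j
theorem2p1 _ _ _ _ _ _ _ 0F 0F _ j≢k _ = contradiction ≡.refl j≢k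
theorem2p1 _ _ _ _ _ _ _ 1F 1F _ j≢k _ = contradiction ≡.refl j≢k
theorem2p1 _ _ _ _ _ _ _ 2F 2F _ j≢k _ = contradiction ≡.refl j≢k
theorem2p1 _ _ _ _ _ _ 0F _ 0F _ _ i≢k = contradiction ≡.refl i≢k
theorem2p1 _ _ _ _ _ _ 1F _ 1F _ _ i≢k = contradiction ≡.refl i≢k
theorem2p1 _ _ _ _ _ _ 2F _ 2F _ _ i≢k = contradiction ≡.refl i≢k
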